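{- Consider a run of the Edge Rounding Procedure on an instance of the edge-arrival problem with an optimal solution $\mathbf{x}$ of LP-E. For every iteration $t$, with $e_t=(v,u)$, the probability that the condition "$u$ is alive, $e_t$ is realized, and $b=1$" holds in iteration $t$ is exactly $x_{e_t}$.
   Context: Problem (edge arrivals). We are given a bipartite graph $G=(A,B,E)$, non-negative edge weights $w_e$, a probability $p_e\in[0,1]$ for each edge, and a fixed order $e_1,\dots,e_{|E|}$ of $E$. Edges are written $(v,u)$ with $v\in A$, $u\in B$. At time $t$ the edge $e_t$ is realized with probability $p_{e_t}$, independently of everything else. For edges $e,e'$ write $e'<e$ if $e'$ precedes $e$ in the order. LP-E: maximize $\sum_{e}w_ex_e$ subject to $\sum_{e\ni z}x_e\le1$ for all $z\in A\cup B$; $p_e(1-\sum_{e'\ni v,\,e'<e}x_{e'})\ge x_e$ and $p_e(1-\sum_{e'\ni u,\,e'<e}x_{e'})\ge x_e$ for all $e=(v,u)\in E$; $x\ge0$. Edge Rounding Procedure: $M=\emptyset$, all vertices alive. For $t=1,\dots,|E|$: let $e_t=(v,u)$; set $\alpha_u=\sum_{e\ni u,\,e<e_t}x_e$ and $\alpha_v=\sum_{e\ni v,\,e<e_t}x_e$; let $b$ be a Bernoulli variable equal to $1$ with probability $\frac{x_{e_t}}{p_{e_t}(1-\alpha_u)}$; if $u$ is alive, $e_t$ is realized and $b=1$, then: if $v$ is also alive, with probability $\frac{1}{2-\alpha_v}$ add $e_t$ to $M$ and mark $v$ dead; and in any case mark $u$ dead. All random choices are independent. Output $M$.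
   Formalization: The edge probabilities $p_e$, the edge weights $w_e$ and the optimal solution $\mathbf{x}$ of LP-E are rational, and optimality of $\mathbf{x}$ is taken among rational feasible solutions. -}

module Defs where

open import Data.Bool using (Bool; true; false; if_then_else_; _∧_)
open import Data.Nat as ℕ using (ℕ; zero; suc)
open import Data.Fin using (Fin; toℕ)
import Data.Fin as F
open import Data.Fin.Properties using () renaming (_≟_ to _≟ᶠ_)
open import Data.Product using (_×_; _,_; proj₁; proj₂)
open import Data.List as L using (List; []; _∷_)
open import Data.Rational using (ℚ; 0ℚ; 1ℚ; _+_; _*_; _-_; _÷_; _≤_; ≢-nonZero)
open import Data.Rational.Properties using () renaming (_≟_ to _≟ℚ_)
open import Relation.Binary.PropositionalEquality using (_≡_; _≢_)
open import Relation.Nullary using (yes; no; does; ¬_)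
open import Function.Definitions using (Injective)

sumFin : (m : ℕ) → (Fin m → ℚ) → ℚ
sumFin zero    f = 0ℚ
sumFin (suc m) f = f F.zero + sumFin m (λ i → f (F.suc i))

-- A = Fin na, B = Fin nb, the m edges are indexed by Fin m in arrival
-- order: edge index s precedes edge index t iff toℕ s < toℕ t.
-- edge t = (v , u) with v ∈ A, u ∈ B.

record Instance (na nb m : ℕ) : Set where
  field
    edge : Fin m → Fin na × Fin nb
    w    : Fin m → ℚ
    p    : Fin m → ℚ
open Instance public

endA : ∀ {na nb m} → Instance na nb m → Fin m → Fin na
endA I t = proj₁ (edge I t)

endB : ∀ {na nb m} → Instance na nb m → Fin m → Fin nb
endB I t = proj₂ (edge I t)

WellFormed : ∀ {na nb m} → Instance na nb m → Set
WellFormed {m = m} I =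
  Injective _≡_ _≡_ (edge I) ×
  ((t : Fin m) → 0ℚ ≤ w I t) ×
  ((t : Fin m) → (0ℚ ≤ p I t) × (p I t ≤ 1ℚ))

before : ∀ {m} → Fin m → Fin m → Bool
before s t = does (toℕ s ℕ.<? toℕ t)

loadA : ∀ {na nb m} → Instance na nb m → (Fin m → ℚ) → Fin na → ℚ
loadA {m = m} I x a = sumFin m (λ s → if does (endA I s ≟ᶠ a) then x s else 0ℚ)

loadB : ∀ {na nb m} → Instance na nb m → (Fin m → ℚ) → Fin nb → ℚ
loadB {m = m} I x b = sumFin m (λ s → if does (endB I s ≟ᶠ b) then x s else 0ℚ)

alphaA : ∀ {na nb m} → Instance na nb m → (Fin m → ℚ) → Fin m → ℚ
alphaA {m = m} I x t =
  sumFin m (λ s → if before s t ∧ does (endA I s ≟ᶠ endA I t) then x s else 0ℚ)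

alphaB : ∀ {na nb m} → Instance na nb m → (Fin m → ℚ) → Fin m → ℚ
alphaB {m = m} I x t =
  sumFin m (λ s → if before s t ∧ does (endB I s ≟ᶠ endB I t) then x s else 0ℚ)

Feasible : ∀ {na nb m} → Instance na nb m → (Fin m → ℚ) → Set
Feasible {na} {nb} {m} I x =
  ((a : Fin na) → loadA I x a ≤ 1ℚ) ×
  ((b : Fin nb) → loadB I x b ≤ 1ℚ) ×
  ((t : Fin m) → x t ≤ p I t * (1ℚ - alphaA I x t)) ×
  ((t : Fin m) → x t ≤ p I t * (1ℚ - alphaB I x t)) ×
  ((t : Fin m) → 0ℚ ≤ x t)

objective : ∀ {na nb m} → Instance na nb m → (Fin m → ℚ) → ℚ
objective {m = m} I x = sumFin m (λ t → w I t * x t)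

Optimal : ∀ {na nb m} → Instance na nb m → (Fin m → ℚ) → Set
Optimal {m = m} I x =
  Feasible I x × ((y : Fin m → ℚ) → Feasible I y → objective I y ≤ objective I x)

Dist : Set → Set
Dist S = List (ℚ × S)

ret : ∀ {S} → S → Dist S
ret s = (1ℚ , s) ∷ []

bind : ∀ {S T} → Dist S → (S → Dist T) → Dist T
bind d f = L.concatMap (λ ps → L.map (λ qt → (proj₁ ps * proj₁ qt , proj₂ qt)) (f (proj₂ ps))) d

bern : ℚ → Dist Bool
bern q = (q , true) ∷ (1ℚ - q , false) ∷ []

prob : ∀ {S} → Dist S → (S → Bool) → ℚ
prob []             P = 0ℚ
prob ((a , s) ∷ d) P = (if P s then a else 0ℚ) + prob d P

-- division with the convention a / 0 = 0 (only used where, by LP-E,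
-- a denominator 0 forces the numerator to be 0)
div : ℚ → ℚ → ℚ
div a b with b ≟ℚ 0ℚ
... | yes _  = 0ℚ
... | no b≢0 = _÷_ a b {{≢-nonZero b≢0}}

record State (na nb m : ℕ) : Set where
  constructor st
  field
    aliveA : Fin na → Bool
    aliveB : Fin nb → Bool
    matching : List (Fin m)
open State public

initState : ∀ {na nb m} → State na nb m
initState = st (λ _ → true) (λ _ → true) []

killA : ∀ {na} → (Fin na → Bool) → Fin na → Fin na → Bool
killA al v a = if does (a ≟ᶠ v) then false else al a

killB : ∀ {nb} → (Fin nb → Bool) → Fin nb → Fin nb → Bool
killB al u b = if does (b ≟ᶠ u) then false else al b

stepEv : ∀ {na nb m} → Instance na nb m → (Fin m → ℚ) → Fin m →
         State na nb m → Dist (State na nb m × Bool)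
stepEv I x t σ =
  bind (bern (p I t)) λ realized →
  bind (bern (div (x t) (p I t * (1ℚ - alphaB I x t)))) λ b →
  bind (bern (div 1ℚ ((1ℚ + 1ℚ) - alphaA I x t))) λ coin →
    let v = endA I t
        u = endB I t
        cond = aliveB σ u ∧ realized ∧ b
    in if cond
       then (if aliveA σ v ∧ coin
             then ret (st (killA (aliveA σ) v) (killB (aliveB σ) u) (t ∷ matching σ) , true)
             else ret (st (aliveA σ) (killB (aliveB σ) u) (matching σ) , true))
       else ret (σ , false)

step : ∀ {na nb m} → Instance na nb m → (Fin m → ℚ) → Fin m →
       State na nb m → Dist (State na nb m)
step I x t σ = bind (stepEv I x t σ) (λ r → ret (proj₁ r))

runList : ∀ {na nb m} → Instance na nb m → (Fin m → ℚ) → List (Fin m) →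
          Dist (State na nb m) → Dist (State na nb m)
runList I x []       d = d
runList I x (s ∷ ss) d = runList I x ss (bind d (step I x s))

stateBefore : ∀ {na nb m} → Instance na nb m → (Fin m → ℚ) → Fin m →
              Dist (State na nb m)
stateBefore {m = m} I x t =
  runList I x (L.filterᵇ (λ s → before s t) (L.allFin m)) (ret initState)

condProb : ∀ {na nb m} → Instance na nb m → (Fin m → ℚ) → Fin m → ℚ
condProb I x t = prob (bind (stateBefore I x t) (stepEv I x t)) proj₂

-- Fix u = endB t and let b_s = x_s / (p_s (1 − α_u(s))) be the parameter of b in
-- iteration s. Seen from u, an iteration s with endB s = u is a Bernoulli(p_s b_s)
-- trial, independent of the past and of the A-side coin, which kills u if u is alive;
-- iterations at other B-vertices leave u alone. By induction over the iterations,
-- u is therefore alive at the start of iteration s with probability 1 − α_u(s), as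
-- (1 − α_u(s)) (1 − p_s b_s) = 1 − α_u(s) − x_s; so the condition holds in iteration t
-- with probability (1 − α_u(t)) p_t b_t = x_t.
module Submission where

open import Defs
open import Data.Nat using (ℕ)
open import Data.Fin using (Fin)
open import Data.Rational using (ℚ)
open import Relation.Binary.PropositionalEquality using (_≡_)

open import Data.Bool using (Bool; true; false; if_then_else_; _∧_)
open import Data.Bool.Properties using (if-eta)
open import Data.Nat using (zero; suc; _<ᵇ_) renaming (_≤_ to _≤ℕ_)
open import Data.Nat.Properties using (<⇒≤)
open import Data.Fin using (toℕ; fromℕ<)
import Data.Fin as Fin
open import Data.Fin.Properties using (toℕ<n; toℕ-fromℕ<) renaming (_≟_ to _≟ᶠ_)
open import Data.Product using (_×_; _,_; proj₁; proj₂)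
open import Data.List as List using (List; []; _∷_; [_]; _++_; _∷ʳ_)
open import Data.List.Properties using (map-tabulate; map-++)
open import Data.Rational using (0ℚ; 1ℚ; _+_; _*_; _-_; 1/_; _≤_; ≢-nonZero)
open import Data.Rational.Properties
  using (+-identityˡ; +-identityʳ; *-identityˡ; *-identityʳ; *-zeroˡ; *-zeroʳ; +-assoc; ≤-antisym; *-inverseʳ)
  renaming (_≟_ to _≟ℚ_)
open import Data.Rational.Solver using (module +-*-Solver)
open import Function using (_∘_; id)
open import Relation.Binary.PropositionalEquality using (_≢_; refl; sym; trans; cong; cong₂; module ≡-Reasoning)
open import Relation.Nullary using (yes; no; does)
open import Relation.Nullary.Decidable using (dec-true; dec-false)

open +-*-Solver
open ≡-Reasoning

𝟙 : Bool → ℚ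
𝟙 c = if c then 1ℚ else 0ℚ

𝔼 : ∀ {S : Set} → Dist S → (S → ℚ) → ℚ
𝔼 []            g = 0ℚ
𝔼 ((a , s) ∷ d) g = a * g s + 𝔼 d g

prob-𝔼 : ∀ {S : Set} (d : Dist S) (P : S → Bool) → prob d P ≡ 𝔼 d (𝟙 ∘ P)
prob-𝔼 []            P = refl
prob-𝔼 ((a , s) ∷ d) P = cong₂ _+_ (weight (P s)) (prob-𝔼 d P)
  where
  weight : ∀ c → (if c then a else 0ℚ) ≡ a * 𝟙 c
  weight true  = sym (*-identityʳ a)
  weight false = sym (*-zeroʳ a)

𝔼-cong : ∀ {S : Set} (d : Dist S) {g h : S → ℚ} → (∀ s → g s ≡ h s) → 𝔼 d g ≡ 𝔼 d h
𝔼-cong []            g≗h = refl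
𝔼-cong ((a , s) ∷ d) g≗h = cong₂ _+_ (cong (a *_) (g≗h s)) (𝔼-cong d g≗h)

𝔼-ret : ∀ {S : Set} (s : S) (g : S → ℚ) → 𝔼 (ret s) g ≡ g s
𝔼-ret s g = trans (+-identityʳ _) (*-identityˡ (g s))

𝔼-++ : ∀ {S : Set} (d₁ d₂ : Dist S) (g : S → ℚ) → 𝔼 (d₁ ++ d₂) g ≡ 𝔼 d₁ g + 𝔼 d₂ g
𝔼-++ []             d₂ g = sym (+-identityˡ _)
𝔼-++ ((a , s) ∷ d₁) d₂ g = trans (cong (a * g s +_) (𝔼-++ d₁ d₂ g)) (sym (+-assoc (a * g s) (𝔼 d₁ g) (𝔼 d₂ g)))

𝔼-rescale : ∀ {S : Set} (c : ℚ) (d : Dist S) (g : S → ℚ) →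
            𝔼 (List.map (λ qt → (c * proj₁ qt , proj₂ qt)) d) g ≡ c * 𝔼 d g
𝔼-rescale c []            g = sym (*-zeroʳ c)
𝔼-rescale c ((a , s) ∷ d) g = trans (cong (c * a * g s +_) (𝔼-rescale c d g)) (distrib c a (g s) (𝔼 d g))
  where
  distrib : ∀ c a y z → c * a * y + c * z ≡ c * (a * y + z)
  distrib = solve 4 (λ c a y z → c :* a :* y :+ c :* z := c :* (a :* y :+ z)) refl

𝔼-bind : ∀ {S T : Set} (d : Dist S) (f : S → Dist T) (g : T → ℚ) →
         𝔼 (bind d f) g ≡ 𝔼 d (λ s → 𝔼 (f s) g)
𝔼-bind []            f g = refl
𝔼-bind ((a , s) ∷ d) f g =
  trans (𝔼-++ (List.map (λ qt → (a * proj₁ qt , proj₂ qt)) (f s)) (bind d f) g)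
        (cong₂ _+_ (𝔼-rescale a (f s) g) (𝔼-bind d f g))

𝔼-*ʳ : ∀ {S : Set} (d : Dist S) (g : S → ℚ) (c : ℚ) → 𝔼 d (λ s → g s * c) ≡ 𝔼 d g * c
𝔼-*ʳ []            g c = sym (*-zeroˡ c)
𝔼-*ʳ ((a , s) ∷ d) g c = trans (cong (a * (g s * c) +_) (𝔼-*ʳ d g c)) (distrib a (g s) (𝔼 d g) c)
  where
  distrib : ∀ a y z c → a * (y * c) + z * c ≡ (a * y + z) * c
  distrib = solve 4 (λ a y z c → a :* (y :* c) :+ z :* c := (a :* y :+ z) :* c) refl

𝔼-bern-const : ∀ a (K : ℚ) → 𝔼 (bern a) (λ _ → K) ≡ K
𝔼-bern-const = solve 2 (λ a K → a :* K :+ ((con 1ℚ :- a) :* K :+ con 0ℚ) := K) refl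

𝔼-bern-∧ : ∀ a b (F : Bool → ℚ) →
           𝔼 (bern a) (λ r → 𝔼 (bern b) (λ r′ → F (r ∧ r′))) ≡ 𝔼 (bern (a * b)) F
𝔼-bern-∧ a b F = expand a b (F true) (F false)
  where
  expand : ∀ a b T F →
    a * (b * T + ((1ℚ - b) * F + 0ℚ)) + ((1ℚ - a) * (b * F + ((1ℚ - b) * F + 0ℚ)) + 0ℚ)
    ≡ a * b * T + ((1ℚ - a * b) * F + 0ℚ)
  expand = solve 4 (λ a b T F →
    a :* (b :* T :+ ((con 1ℚ :- b) :* F :+ con 0ℚ))
      :+ ((con 1ℚ :- a) :* (b :* F :+ ((con 1ℚ :- b) :* F :+ con 0ℚ)) :+ con 0ℚ)
    := a :* b :* T :+ ((con 1ℚ :- a :* b) :* F :+ con 0ℚ)) refl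

𝔼-bern-𝟙∧ : ∀ a c → 𝔼 (bern a) (λ r → 𝟙 (c ∧ r)) ≡ 𝟙 c * a
𝔼-bern-𝟙∧ a true  = solve 1 (λ a → a :* con 1ℚ :+ ((con 1ℚ :- a) :* con 0ℚ :+ con 0ℚ) := con 1ℚ :* a) refl a
𝔼-bern-𝟙∧ a false = solve 1 (λ a → a :* con 0ℚ :+ ((con 1ℚ :- a) :* con 0ℚ :+ con 0ℚ) := con 0ℚ :* a) refl a

𝔼-bern-unless : ∀ a c → 𝔼 (bern a) (λ r → if c ∧ r then 0ℚ else 𝟙 c) ≡ 𝟙 c * (1ℚ - a)
𝔼-bern-unless a true  =
  solve 1 (λ a → a :* con 0ℚ :+ ((con 1ℚ :- a) :* con 1ℚ :+ con 0ℚ) := con 1ℚ :* (con 1ℚ :- a)) refl a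
𝔼-bern-unless a false =
  solve 1 (λ a → a :* con 0ℚ :+ ((con 1ℚ :- a) :* con 0ℚ :+ con 0ℚ) := con 0ℚ :* (con 1ℚ :- a)) refl a

*-div-cancel : ∀ {a b} → 0ℚ ≤ a → a ≤ b → b * div a b ≡ a
*-div-cancel {a} {b} 0≤a a≤b with b ≟ℚ 0ℚ
... | yes refl = ≤-antisym 0≤a a≤b
... | no  b≢0  = begin
  b * (a * 1/ b)  ≡⟨ exchange b a (1/ b) ⟩
  a * (b * 1/ b)  ≡⟨ cong (a *_) (*-inverseʳ b) ⟩
  a * 1ℚ          ≡⟨ *-identityʳ a ⟩
  a               ∎
  where
  instance _ = ≢-nonZero b≢0
  exchange : ∀ b a c → b * (a * c) ≡ a * (b * c)
  exchange = solve 3 (λ b a c → b :* (a :* c) := a :* (b :* c)) refl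

sumFin-zero : ∀ n → sumFin n (λ _ → 0ℚ) ≡ 0ℚ
sumFin-zero zero    = refl
sumFin-zero (suc n) = trans (cong (0ℚ +_) (sumFin-zero n)) (+-identityˡ 0ℚ)

sumFin-<ᵇ-suc : ∀ {n} (P : Fin n → Bool) (f : Fin n → ℚ) (s : Fin n) →
                sumFin n (λ i → if (toℕ i <ᵇ suc (toℕ s)) ∧ P i then f i else 0ℚ)
                ≡ sumFin n (λ i → if (toℕ i <ᵇ toℕ s) ∧ P i then f i else 0ℚ) + (if P s then f s else 0ℚ)
sumFin-<ᵇ-suc {suc n} P f Fin.zero rewrite sumFin-zero n = swap (if P Fin.zero then f Fin.zero else 0ℚ)
  where
  swap : ∀ c → c + 0ℚ ≡ (0ℚ + 0ℚ) + c
  swap = solve 1 (λ c → c :+ con 0ℚ := (con 0ℚ :+ con 0ℚ) :+ c) refl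
sumFin-<ᵇ-suc {suc n} P f (Fin.suc s) =
  trans (cong (head +_) (sumFin-<ᵇ-suc (P ∘ Fin.suc) (f ∘ Fin.suc) s)) (sym (+-assoc head _ _))
  where
  head = if P Fin.zero then f Fin.zero else 0ℚ

filterᵇ-const-false : ∀ {A : Set} (xs : List A) → List.filterᵇ (λ _ → false) xs ≡ []
filterᵇ-const-false []       = refl
filterᵇ-const-false (_ ∷ xs) = filterᵇ-const-false xs

filterᵇ-map : ∀ {A B : Set} (P : B → Bool) (f : A → B) (xs : List A) →
              List.filterᵇ P (List.map f xs) ≡ List.map f (List.filterᵇ (P ∘ f) xs)
filterᵇ-map P f []       = refl
filterᵇ-map P f (x ∷ xs) with P (f x)
... | true  = cong (f x ∷_) (filterᵇ-map P f xs)
... | false = filterᵇ-map P f xs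

below : ∀ n → ℕ → List (Fin n)
below n k = List.filterᵇ (λ i → toℕ i <ᵇ k) (List.allFin n)

below-zero : ∀ n → below n 0 ≡ []
below-zero n = filterᵇ-const-false (List.allFin n)

below-suc : ∀ n k → below (suc n) (suc k) ≡ Fin.zero ∷ List.map Fin.suc (below n k)
below-suc n k = cong (Fin.zero ∷_) (begin
  List.filterᵇ P (List.tabulate Fin.suc)            ≡⟨ cong (List.filterᵇ P) (sym (map-tabulate id Fin.suc)) ⟩
  List.filterᵇ P (List.map Fin.suc (List.allFin n)) ≡⟨ filterᵇ-map P Fin.suc (List.allFin n) ⟩
  List.map Fin.suc (below n k)                      ∎)
  where
  P : Fin (suc n) → Bool
  P i = toℕ i <ᵇ suc k

below-snoc : ∀ {n} (s : Fin n) → below n (suc (toℕ s)) ≡ below n (toℕ s) ∷ʳ s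
below-snoc {suc n} Fin.zero = begin
  below (suc n) 1                             ≡⟨ below-suc n 0 ⟩
  Fin.zero ∷ List.map Fin.suc (below n 0)     ≡⟨ cong (λ l → Fin.zero ∷ List.map Fin.suc l) (below-zero n) ⟩
  [ Fin.zero ]                                ≡⟨ cong (_∷ʳ Fin.zero) (sym (below-zero (suc n))) ⟩
  below (suc n) 0 ∷ʳ Fin.zero                 ∎
below-snoc {suc n} (Fin.suc s) = begin
  below (suc n) (suc (suc (toℕ s)))                      ≡⟨ below-suc n (suc (toℕ s)) ⟩
  Fin.zero ∷ List.map Fin.suc (below n (suc (toℕ s)))   ≡⟨ cong (λ l → Fin.zero ∷ List.map Fin.suc l) (below-snoc s) ⟩
  Fin.zero ∷ List.map Fin.suc (below n (toℕ s) ∷ʳ s)    ≡⟨ cong (Fin.zero ∷_) (map-++ Fin.suc (below n (toℕ s)) [ s ]) ⟩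
  Fin.zero ∷ (List.map Fin.suc (below n (toℕ s)) ∷ʳ Fin.suc s) ≡⟨ cong (_∷ʳ Fin.suc s) (sym (below-suc n (toℕ s))) ⟩
  below (suc n) (suc (toℕ s)) ∷ʳ Fin.suc s              ∎

killB-self : ∀ {n} (al : Fin n → Bool) u → killB al u u ≡ false
killB-self al u rewrite dec-true (u ≟ᶠ u) refl = refl

killB-other : ∀ {n} (al : Fin n → Bool) {u w} → u ≢ w → killB al u w ≡ al w
killB-other al {u} {w} u≢w rewrite dec-false (w ≟ᶠ u) (u≢w ∘ sym) = refl

module Rounding {na nb m : ℕ} (I : Instance na nb m) (x : Fin m → ℚ) where

  bProb : Fin m → ℚ
  bProb t = div (x t) (p I t * (1ℚ - alphaB I x t))

  accept : Fin m → ℚ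
  accept t = p I t * bProb t

  coinProb : Fin m → ℚ
  coinProb t = div 1ℚ ((1ℚ + 1ℚ) - alphaA I x t)

  matched unmatched : Fin m → State na nb m → State na nb m
  matched   t σ = st (killA (aliveA σ) (endA I t)) (killB (aliveB σ) (endB I t)) (t ∷ matching σ)
  unmatched t σ = st (aliveA σ) (killB (aliveB σ) (endB I t)) (matching σ)

  -- stepEv I x t σ unfolds definitionally to Bernoulli draws of the realization,
  -- of b and of the coin, followed by outcome.
  outcome : Fin m → State na nb m → (cond matchV : Bool) → Dist (State na nb m × Bool)
  outcome t σ cond matchV =
    if cond then (if matchV then ret (matched t σ , true) else ret (unmatched t σ , true))
    else ret (σ , false)

  observeB : State na nb m × Bool → (Fin nb → Bool) × Bool
  observeB r = aliveB (proj₁ r) , proj₂ r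

  𝔼-outcome : ∀ t σ cond matchV (h : (Fin nb → Bool) × Bool → ℚ) →
    𝔼 (outcome t σ cond matchV) (h ∘ observeB)
    ≡ (if cond then h (killB (aliveB σ) (endB I t) , true) else h (aliveB σ , false))
  𝔼-outcome t σ true  true  h = 𝔼-ret (matched t σ , true) (h ∘ observeB)
  𝔼-outcome t σ true  false h = 𝔼-ret (unmatched t σ , true) (h ∘ observeB)
  𝔼-outcome t σ false _     h = 𝔼-ret (σ , false) (h ∘ observeB)

  stepEv-observeB : ∀ t σ (h : (Fin nb → Bool) × Bool → ℚ) →
    𝔼 (stepEv I x t σ) (h ∘ observeB)
    ≡ 𝔼 (bern (accept t)) (λ c → if aliveB σ (endB I t) ∧ c
                                  then h (killB (aliveB σ) (endB I t) , true)
                                  else h (aliveB σ , false))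
  stepEv-observeB t σ h = begin
      𝔼 (stepEv I x t σ) g
    ≡⟨ 𝔼-bind (bern (p I t)) afterRealization g ⟩
      𝔼 (bern (p I t)) (λ r → 𝔼 (afterRealization r) g)
    ≡⟨ 𝔼-cong (bern (p I t)) (λ r → 𝔼-bind (bern (bProb t)) (afterB r) g) ⟩
      𝔼 (bern (p I t)) (λ r → 𝔼 (bern (bProb t)) (λ b → 𝔼 (afterB r b) g))
    ≡⟨ 𝔼-cong (bern (p I t)) (λ r → 𝔼-cong (bern (bProb t)) (coin-invisible r)) ⟩
      𝔼 (bern (p I t)) (λ r → 𝔼 (bern (bProb t)) (λ b → F (r ∧ b)))
    ≡⟨ 𝔼-bern-∧ (p I t) (bProb t) F ⟩
      𝔼 (bern (accept t)) F
    ∎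
    where
    g = h ∘ observeB
    F : Bool → ℚ
    F c = if aliveB σ (endB I t) ∧ c then h (killB (aliveB σ) (endB I t) , true) else h (aliveB σ , false)
    afterCoin : Bool → Bool → Bool → Dist (State na nb m × Bool)
    afterCoin r b coin = outcome t σ (aliveB σ (endB I t) ∧ r ∧ b) (aliveA σ (endA I t) ∧ coin)
    afterB : Bool → Bool → Dist (State na nb m × Bool)
    afterB r b = bind (bern (coinProb t)) (afterCoin r b)
    afterRealization : Bool → Dist (State na nb m × Bool)
    afterRealization r = bind (bern (bProb t)) (afterB r)
    coin-invisible : ∀ r b → 𝔼 (afterB r b) g ≡ F (r ∧ b)
    coin-invisible r b =
      trans (𝔼-bind (bern (coinProb t)) (afterCoin r b) g)
            (trans (𝔼-cong (bern (coinProb t)) λ coin →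
                      𝔼-outcome t σ (aliveB σ (endB I t) ∧ r ∧ b) (aliveA σ (endA I t) ∧ coin) h)
                   (𝔼-bern-const (coinProb t) (F (r ∧ b))))

  𝟙aliveB : Fin nb → State na nb m → ℚ
  𝟙aliveB w σ = 𝟙 (aliveB σ w)

  stepEv-condition : ∀ t σ → 𝔼 (stepEv I x t σ) (𝟙 ∘ proj₂) ≡ 𝟙aliveB (endB I t) σ * accept t
  stepEv-condition t σ =
    trans (stepEv-observeB t σ (𝟙 ∘ proj₂)) (𝔼-bern-𝟙∧ (accept t) (aliveB σ (endB I t)))

  𝔼-step : ∀ t σ (g : State na nb m → ℚ) → 𝔼 (step I x t σ) g ≡ 𝔼 (stepEv I x t σ) (g ∘ proj₁)
  𝔼-step t σ g =
    trans (𝔼-bind (stepEv I x t σ) (ret ∘ proj₁) g) (𝔼-cong (stepEv I x t σ) (λ r → 𝔼-ret (proj₁ r) g))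

  step-kills : ∀ t σ → 𝔼 (step I x t σ) (𝟙aliveB (endB I t)) ≡ 𝟙aliveB (endB I t) σ * (1ℚ - accept t)
  step-kills t σ = begin
      𝔼 (step I x t σ) (𝟙aliveB u)
    ≡⟨ 𝔼-step t σ (𝟙aliveB u) ⟩
      𝔼 (stepEv I x t σ) (𝟙aliveB u ∘ proj₁)
    ≡⟨ stepEv-observeB t σ (λ o → 𝟙 (proj₁ o u)) ⟩
      𝔼 (bern (accept t)) (λ c → if al u ∧ c then 𝟙 (killB al u u) else 𝟙 (al u))
    ≡⟨ 𝔼-cong (bern (accept t)) (λ c → cong (λ z → if al u ∧ c then 𝟙 z else 𝟙 (al u)) (killB-self al u)) ⟩
      𝔼 (bern (accept t)) (λ c → if al u ∧ c then 0ℚ else 𝟙 (al u))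
    ≡⟨ 𝔼-bern-unless (accept t) (al u) ⟩
      𝟙 (al u) * (1ℚ - accept t)
    ∎
    where
    u = endB I t
    al = aliveB σ

  step-spares : ∀ t σ {w} → endB I t ≢ w → 𝔼 (step I x t σ) (𝟙aliveB w) ≡ 𝟙aliveB w σ
  step-spares t σ {w} u≢w = begin
      𝔼 (step I x t σ) (𝟙aliveB w)
    ≡⟨ 𝔼-step t σ (𝟙aliveB w) ⟩
      𝔼 (stepEv I x t σ) (𝟙aliveB w ∘ proj₁)
    ≡⟨ stepEv-observeB t σ (λ o → 𝟙 (proj₁ o w)) ⟩
      𝔼 (bern (accept t)) (λ c → if al u ∧ c then 𝟙 (killB al u w) else 𝟙 (al w))
    ≡⟨ 𝔼-cong (bern (accept t)) (λ c → trans (cong (λ z → if al u ∧ c then 𝟙 z else 𝟙 (al w))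
                                                    (killB-other al u≢w))
                                              (if-eta (al u ∧ c))) ⟩
      𝔼 (bern (accept t)) (λ _ → 𝟙 (al w))
    ≡⟨ 𝔼-bern-const (accept t) (𝟙 (al w)) ⟩
      𝟙 (al w)
    ∎
    where
    u = endB I t
    al = aliveB σ

  alive-accept≡x : ∀ t → 0ℚ ≤ x t → x t ≤ p I t * (1ℚ - alphaB I x t) →
                   (1ℚ - alphaB I x t) * accept t ≡ x t
  alive-accept≡x t 0≤x x≤ = trans (exchange (1ℚ - alphaB I x t) (p I t) (bProb t)) (*-div-cancel 0≤x x≤)
    where
    exchange : ∀ a b c → a * (b * c) ≡ b * a * c
    exchange = solve 3 (λ a b c → a :* (b :* c) := b :* a :* c) refl

  -- Since does (i <? k) reduces to i <ᵇ k, Defs' stateBefore I x t and alphaB I x t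
  -- are definitionally runUpTo (toℕ t) and loadBefore (endB I t) (toℕ t).
  runUpTo : ℕ → Dist (State na nb m)
  runUpTo k = runList I x (below m k) (ret initState)

  loadBefore : Fin nb → ℕ → ℚ
  loadBefore w k = sumFin m (λ s → if (toℕ s <ᵇ k) ∧ does (endB I s ≟ᶠ w) then x s else 0ℚ)

  loadBefore-suc : ∀ s w →
    loadBefore w (suc (toℕ s)) ≡ loadBefore w (toℕ s) + (if does (endB I s ≟ᶠ w) then x s else 0ℚ)
  loadBefore-suc s w = sumFin-<ᵇ-suc (λ i → does (endB I i ≟ᶠ w)) x s

  runList-∷ʳ : ∀ ss s d → runList I x (ss ∷ʳ s) d ≡ bind (runList I x ss d) (step I x s)
  runList-∷ʳ []        s d = refl
  runList-∷ʳ (s′ ∷ ss) s d = runList-∷ʳ ss s (bind d (step I x s′))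

  𝔼-runUpTo-suc : ∀ s (g : State na nb m → ℚ) →
    𝔼 (runUpTo (suc (toℕ s))) g ≡ 𝔼 (runUpTo (toℕ s)) (λ σ → 𝔼 (step I x s σ) g)
  𝔼-runUpTo-suc s g = begin
      𝔼 (runList I x (below m (suc (toℕ s))) (ret initState)) g
    ≡⟨ cong (λ l → 𝔼 (runList I x l (ret initState)) g) (below-snoc s) ⟩
      𝔼 (runList I x (below m (toℕ s) ∷ʳ s) (ret initState)) g
    ≡⟨ cong (λ d → 𝔼 d g) (runList-∷ʳ (below m (toℕ s)) s (ret initState)) ⟩
      𝔼 (bind (runUpTo (toℕ s)) (step I x s)) g
    ≡⟨ 𝔼-bind (runUpTo (toℕ s)) (step I x s) g ⟩
      𝔼 (runUpTo (toℕ s)) (λ σ → 𝔼 (step I x s σ) g)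
    ∎

  Survival : ℕ → Set
  Survival k = ∀ w → 𝔼 (runUpTo k) (𝟙aliveB w) ≡ 1ℚ - loadBefore w k

  module _ (x≥0 : ∀ t → 0ℚ ≤ x t) (x≤ : ∀ t → x t ≤ p I t * (1ℚ - alphaB I x t)) where

    survival-step : ∀ s → Survival (toℕ s) → Survival (suc (toℕ s))
    survival-step s ih w with endB I s ≟ᶠ w | loadBefore-suc s w
    ... | yes refl | load-suc = begin
        𝔼 (runUpTo (suc (toℕ s))) (𝟙aliveB u)
      ≡⟨ 𝔼-runUpTo-suc s (𝟙aliveB u) ⟩
        𝔼 (runUpTo (toℕ s)) (λ σ → 𝔼 (step I x s σ) (𝟙aliveB u))
      ≡⟨ 𝔼-cong (runUpTo (toℕ s)) (step-kills s) ⟩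
        𝔼 (runUpTo (toℕ s)) (λ σ → 𝟙aliveB u σ * (1ℚ - accept s))
      ≡⟨ 𝔼-*ʳ (runUpTo (toℕ s)) (𝟙aliveB u) (1ℚ - accept s) ⟩
        𝔼 (runUpTo (toℕ s)) (𝟙aliveB u) * (1ℚ - accept s)
      ≡⟨ cong (_* (1ℚ - accept s)) (ih u) ⟩
        (1ℚ - α) * (1ℚ - accept s)
      ≡⟨ expand (1ℚ - α) (accept s) ⟩
        (1ℚ - α) - (1ℚ - α) * accept s
      ≡⟨ cong ((1ℚ - α) -_) (alive-accept≡x s (x≥0 s) (x≤ s)) ⟩
        (1ℚ - α) - x s
      ≡⟨ regroup α (x s) ⟩
        1ℚ - (α + x s)
      ≡⟨ cong (1ℚ -_) (sym load-suc) ⟩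
        1ℚ - loadBefore u (suc (toℕ s))
      ∎
      where
      u = endB I s
      α = alphaB I x s
      expand : ∀ a b → a * (1ℚ - b) ≡ a - a * b
      expand = solve 2 (λ a b → a :* (con 1ℚ :- b) := a :- a :* b) refl
      regroup : ∀ a b → (1ℚ - a) - b ≡ 1ℚ - (a + b)
      regroup = solve 2 (λ a b → (con 1ℚ :- a) :- b := con 1ℚ :- (a :+ b)) refl
    ... | no u≢w | load-suc = begin
        𝔼 (runUpTo (suc (toℕ s))) (𝟙aliveB w)
      ≡⟨ 𝔼-runUpTo-suc s (𝟙aliveB w) ⟩
        𝔼 (runUpTo (toℕ s)) (λ σ → 𝔼 (step I x s σ) (𝟙aliveB w))
      ≡⟨ 𝔼-cong (runUpTo (toℕ s)) (λ σ → step-spares s σ u≢w) ⟩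
        𝔼 (runUpTo (toℕ s)) (𝟙aliveB w)
      ≡⟨ ih w ⟩
        1ℚ - loadBefore w (toℕ s)
      ≡⟨ cong (1ℚ -_) (sym (trans load-suc (+-identityʳ (loadBefore w (toℕ s))))) ⟩
        1ℚ - loadBefore w (suc (toℕ s))
      ∎

    survival : ∀ k → k ≤ℕ m → Survival k
    survival zero _ w = begin
        𝔼 (runUpTo 0) (𝟙aliveB w)
      ≡⟨ cong (λ l → 𝔼 (runList I x l (ret initState)) (𝟙aliveB w)) (below-zero m) ⟩
        𝔼 (ret initState) (𝟙aliveB w)
      ≡⟨ 𝔼-ret initState (𝟙aliveB w) ⟩
        1ℚ
      ≡⟨ cong (1ℚ -_) (sym (sumFin-zero m)) ⟩
        1ℚ - loadBefore w 0
      ∎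
    survival (suc k) k<m w with fromℕ< k<m | toℕ-fromℕ< k<m
    ... | s | refl = survival-step s (survival (toℕ s) (<⇒≤ k<m)) w

lemma5 : {na nb m : ℕ} (I : Instance na nb m) → WellFormed I →
         (x : Fin m → ℚ) → Optimal I x →
         (t : Fin m) → condProb I x t ≡ x t
lemma5 I _ x ((_ , _ , _ , x≤ , x≥0) , _) t = begin
    condProb I x t
  ≡⟨ prob-𝔼 (bind (runUpTo (toℕ t)) (stepEv I x t)) proj₂ ⟩
    𝔼 (bind (runUpTo (toℕ t)) (stepEv I x t)) (𝟙 ∘ proj₂)
  ≡⟨ 𝔼-bind (runUpTo (toℕ t)) (stepEv I x t) (𝟙 ∘ proj₂) ⟩
    𝔼 (runUpTo (toℕ t)) (λ σ → 𝔼 (stepEv I x t σ) (𝟙 ∘ proj₂))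
  ≡⟨ 𝔼-cong (runUpTo (toℕ t)) (stepEv-condition t) ⟩
    𝔼 (runUpTo (toℕ t)) (λ σ → 𝟙aliveB u σ * accept t)
  ≡⟨ 𝔼-*ʳ (runUpTo (toℕ t)) (𝟙aliveB u) (accept t) ⟩
    𝔼 (runUpTo (toℕ t)) (𝟙aliveB u) * accept t
  ≡⟨ cong (_* accept t) (survival x≥0 x≤ (toℕ t) (<⇒≤ (toℕ<n t)) u) ⟩
    (1ℚ - alphaB I x t) * accept t
  ≡⟨ alive-accept≡x t (x≥0 t) (x≤ t) ⟩
    x t
  ∎
  where
  open Rounding I x
  u = endB I t
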